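{- If a finite simple graph $G$ has $FD(G)>2$, then there is $k_0$ such that for every integer $k\ge k_0$, $G$ admits a $(2k+1,k)$-configuration.
   Context: A set $D\subseteq V(G)$ is dominating if every vertex not in $D$ has a neighbour in $D$. For positive integers $k,s$, a $(k,s)$-configuration of $G$ is a multiset of $k$ (not necessarily distinct) dominating sets of $G$ such that every vertex belongs to at most $s$ of them. $FD(G)$ is the maximum of $k/s$ over all $(k,s)$ for which $G$ admits a $(k,s)$-configuration. -}

module Defs where

open import Data.Nat using (ℕ; zero; suc; _+_; _*_; _≤_; _<_)
open import Data.Bool using (true; false)
open import Data.Fin using (Fin)
open import Data.Fin.Subset using (Subset; _∈_; _∉_)
open import Data.Vec using (Vec; lookup; _∷_)
open import Data.Product using (Σ; ∃; _×_; _,_)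
open import Relation.Binary.PropositionalEquality using (_≡_)
open import Relation.Nullary using (¬_; Dec; yes; no)
open import Relation.Unary using (Decidable)

record Graph (n : ℕ) : Set₁ where
  field
    Adj   : Fin n → Fin n → Set
    sym   : ∀ {u v} → Adj u v → Adj v u
    irrefl : ∀ {v} → ¬ Adj v v

Dominating : ∀ {n} → Graph n → Subset n → Set
Dominating {n} G D = ∀ (v : Fin n) → v ∉ D → ∃ λ u → Graph.Adj G v u × u ∈ D

count : ∀ {n k} → Vec (Subset n) k → Fin n → ℕ
count {k = zero} _ v = 0
count {k = suc k} (D ∷ Ds) v with lookup D v
... | true  = suc (count Ds v)
... | false = count Ds v

-- A (k,s)-configuration: a multiset (here: a length-k vector) of k dominating
-- sets such that every vertex belongs to at most s of them.
Configuration : ∀ {n} → Graph n → ℕ → ℕ → Set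
Configuration {n} G k s =
  Σ (Vec (Subset n) k) λ Ds →
    (∀ i → Dominating G (lookup Ds i)) × (∀ v → count Ds v ≤ s)

-- FD(G) > 2 : the maximum of k/s over positive (k,s) admitting a
-- (k,s)-configuration exceeds 2, i.e. some such (k,s) has k > 2s.
FD>2 : ∀ {n} → Graph n → Set
FD>2 G = ∃ λ k → ∃ λ s → 0 < k × 0 < s × 2 * s < k × Configuration G k s

-- If some (K,S)-configuration has K > 2S, then for k ≥ S² write k = t + cS with
-- t < S ≤ c (division by S).  Taking c copies of that configuration together with
-- t copies of the whole vertex set gives t + cK ≥ 2k + 1 dominating sets, each
-- vertex in at most t + cS = k of them; discarding surplus sets keeps both properties.
module Submission where

open import Defs
open import Data.Nat using (ℕ; suc; _+_; _*_; _≤_)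
open import Data.Product using (∃)

open import Data.Nat using (zero; _<_; _∸_; NonZero; >-nonZero; z≤n; s≤s)
open import Data.Nat.Properties
open import Data.Nat.DivMod using (_/_; _%_; m≡m%n+[m/n]*n; m%n<n; m*n/n≡m; /-monoˡ-≤)
open import Data.Nat.Tactic.RingSolver using (solve-∀)
open import Data.Bool using (true; false)
open import Data.Fin using (suc)
open import Data.Fin.Subset using (Subset; ⊤; _∉_)
open import Data.Fin.Subset.Properties using (∈⊤)
open import Data.Vec using (Vec; []; _∷_; _++_; replicate; lookup)
open import Data.Vec.Properties using (lookup-replicate)
open import Data.Vec.Relation.Unary.All.Properties using (lookup⁺; lookup⁻; ++⁺)
open import Data.Product using (_,_)
open import Data.Empty using (⊥-elim)
open import Relation.Binary.PropositionalEquality using (_≡_; refl; sym; cong; subst)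

count-++ : ∀ {n m m′} (Ds : Vec (Subset n) m) (Es : Vec (Subset n) m′) v →
           count (Ds ++ Es) v ≡ count Ds v + count Es v
count-++ []       Es v = refl
count-++ (D ∷ Ds) Es v with lookup D v
... | true  = cong suc (count-++ Ds Es v)
... | false = count-++ Ds Es v

count-≤-length : ∀ {n m} (Ds : Vec (Subset n) m) v → count Ds v ≤ m
count-≤-length []       v = z≤n
count-≤-length (D ∷ Ds) v with lookup D v
... | true  = s≤s (count-≤-length Ds v)
... | false = m≤n⇒m≤1+n (count-≤-length Ds v)

count-≤-count-∷ : ∀ {n m} (D : Subset n) (Ds : Vec (Subset n) m) v →
                  count Ds v ≤ count (D ∷ Ds) v
count-≤-count-∷ D Ds v with lookup D v
... | true  = n≤1+n _
... | false = ≤-refl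

suc-2*-≤ : ∀ {c t S K} → 2 * S < K → t < c → suc (2 * (t + c * S)) ≤ t + c * K
suc-2*-≤ {c} {t} {S} {K} 2S<K t<c = begin
  suc (2 * (t + c * S))   ≡⟨ normalise₁ c t S ⟩
  suc t + (t + c * (2 * S)) ≤⟨ +-monoˡ-≤ _ t<c ⟩
  c + (t + c * (2 * S))   ≡⟨ normalise₂ c t S ⟩
  t + c * suc (2 * S)     ≤⟨ +-monoʳ-≤ t (*-monoʳ-≤ c 2S<K) ⟩
  t + c * K               ∎
  where
  open ≤-Reasoning
  normalise₁ : ∀ c t S → suc (2 * (t + c * S)) ≡ suc t + (t + c * (2 * S))
  normalise₁ = solve-∀
  normalise₂ : ∀ c t S → c + (t + c * (2 * S)) ≡ t + c * suc (2 * S)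
  normalise₂ = solve-∀

module _ {n} (G : Graph n) where

  _++ᶜ_ : ∀ {m s m′ s′} → Configuration G m s → Configuration G m′ s′ →
          Configuration G (m + m′) (s + s′)
  (Ds , Ds-dom , Ds-count) ++ᶜ (Es , Es-dom , Es-count) =
    Ds ++ Es ,
    lookup⁺ {P = Dominating G} (++⁺ (lookup⁻ {xs = Ds} Ds-dom) (lookup⁻ {xs = Es} Es-dom)) ,
    λ v → subst (_≤ _) (sym (count-++ Ds Es v)) (+-mono-≤ (Ds-count v) (Es-count v))

  replicateᶜ : ∀ {m s} c → Configuration G m s → Configuration G (c * m) (c * s)
  replicateᶜ zero    C = [] , (λ ()) , λ _ → z≤n
  replicateᶜ (suc c) C = C ++ᶜ replicateᶜ c C

  ⊤-configuration : ∀ t → Configuration G t t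
  ⊤-configuration t =
    replicate t ⊤ ,
    (λ i v v∉ → ⊥-elim (subst (λ D → v ∉ D) (lookup-replicate i ⊤) v∉ ∈⊤)) ,
    count-≤-length (replicate t ⊤)

  dropᶜ : ∀ j {m s} → Configuration G (j + m) s → Configuration G m s
  dropᶜ zero    C = C
  dropᶜ (suc j) (D ∷ Ds , dom , bound) =
    dropᶜ j (Ds , (λ i → dom (suc i)) , λ v → ≤-trans (count-≤-count-∷ D Ds v) (bound v))

  shrinkᶜ : ∀ {m m′ s} → m′ ≤ m → Configuration G m s → Configuration G m′ s
  shrinkᶜ {m} {m′} m′≤m C =
    dropᶜ (m ∸ m′) (subst (λ x → Configuration G x _) (sym (m∸n+n≡m m′≤m)) C)

  configuration-2k+1-k : ∀ {K S} .{{_ : NonZero S}} → 2 * S < K → Configuration G K S →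
                         ∀ k → S * S ≤ k → Configuration G (suc (2 * k)) k
  configuration-2k+1-k {K} {S} 2S<K C k S²≤k =
    subst (λ s → Configuration G (suc (2 * s)) s) (sym k≡t+cS)
      (shrinkᶜ (suc-2*-≤ 2S<K t<c) (⊤-configuration t ++ᶜ replicateᶜ c C))
    where
    t c : ℕ
    t = k % S
    c = k / S
    k≡t+cS : k ≡ t + c * S
    k≡t+cS = m≡m%n+[m/n]*n k S
    S≤c : S ≤ c
    S≤c = subst (_≤ c) (m*n/n≡m S S) (/-monoˡ-≤ S S²≤k)
    t<c : t < c
    t<c = <-≤-trans (m%n<n k S) S≤c

mainTheorem4 : ∀ {n} (G : Graph n) → FD>2 G →
    ∃ λ k₀ → ∀ (k : ℕ) → 1 ≤ k → k₀ ≤ k → Configuration G (suc (2 * k)) k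
mainTheorem4 G (K , S , _ , 0<S , 2S<K , C) =
  S * S , λ k _ → configuration-2k+1-k G {{>-nonZero 0<S}} 2S<K C k
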